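{- For a prime $p$ and integer $d \ge 1$, let $N_p(d)$ be the number of polynomials $f \in \mathbb{F}_p[x]$ of degree $d$ such that $L_p(f-g) \ge 2$ for every square-free polynomial $g \in \mathbb{F}_p[x]$. Then: (1) for any $d \ge 8$, $N_2(d) \ge 2^{d-8}$; (2) for any $d \ge 14$, $N_3(d) \ge 2 \cdot 3^{d-14}$; (3) for any prime $p \ge 5$, $N_p(15) \ge (p-2)p^5$, and for any integer $d \ge 16$, $N_p(d) \ge (p-1)p^{d-10}$.
   Context: $\mathbb{F}_p$ is the field with $p$ elements. For $h \in \mathbb{F}_p[x]$, its length $L_p(h)$ is obtained by representing each coefficient of $h$ by an integer in the interval $(-p/2, p/2]$ and summing the absolute values of these integers. A polynomial in $\mathbb{F}_p[x]$ is square-free if it is not divisible by the square of any polynomial of degree at least $1$. -}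

module Defs where

open import Data.Nat as ℕ using (ℕ; zero; suc; _≤_; _<_; _≤ᵇ_)
open import Data.Integer as ℤ using (ℤ; +_; _%ℕ_)
open import Data.Integer.Divisibility using (_∣_)
open import Data.List using (List; []; _∷_; length; map)
open import Data.Nat.ListAction using (sum)
open import Data.List.Relation.Unary.All using (All)
open import Data.List.Relation.Unary.AllPairs using (AllPairs)
open import Data.Bool using (if_then_else_)
open import Data.Product using (Σ; _×_; ∃)
open import Relation.Nullary using (¬_)

-- Polynomials are coefficient lists (lowest degree first) with integer
-- coefficients; they represent elements of F_p[x] by reducing mod p.
Poly : Set
Poly = List ℤ

coeff : Poly → ℕ → ℤ
coeff []       _       = + 0
coeff (a ∷ f) zero    = a
coeff (a ∷ f) (suc i) = coeff f i

_+ₚ_ : Poly → Poly → Poly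
[]      +ₚ g       = g
f       +ₚ []      = f
(a ∷ f) +ₚ (b ∷ g) = (a ℤ.+ b) ∷ (f +ₚ g)

negₚ : Poly → Poly
negₚ = map (λ a → ℤ.- a)

_-ₚ_ : Poly → Poly → Poly
f -ₚ g = f +ₚ negₚ g

scale : ℤ → Poly → Poly
scale a = map (a ℤ.*_)

_*ₚ_ : Poly → Poly → Poly
[]      *ₚ g = []
(a ∷ f) *ₚ g = scale a g +ₚ (+ 0 ∷ (f *ₚ g))

_≈[_]_ : Poly → ℕ → Poly → Set
f ≈[ p ] g = ∀ i → (+ p) ∣ (coeff f i ℤ.- coeff g i)

HasDegree : ℕ → ℕ → Poly → Set
HasDegree p d h = ¬ ((+ p) ∣ coeff h d) × (∀ i → d < i → (+ p) ∣ coeff h i)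

DegreePos : ℕ → Poly → Set
DegreePos p h = ∃ λ i → 1 ≤ i × ¬ ((+ p) ∣ coeff h i)

Divides : ℕ → Poly → Poly → Set
Divides p h g = ∃ λ q → g ≈[ p ] (h *ₚ q)

SquareFree : ℕ → Poly → Set
SquareFree p g = ∀ h → DegreePos p h → ¬ Divides p (h *ₚ h) g

-- residue of c mod p in [0, p)  (p = 0 never used)
resid : ℕ → ℤ → ℕ
resid zero    c = 0
resid (suc k) c = c %ℕ suc k

-- |c'| where c' is the representative of c mod p in (-p/2, p/2]
absRep : ℕ → ℤ → ℕ
absRep p c = let r = resid p c in
  if (2 ℕ.* r) ≤ᵇ p then r else p ℕ.∸ r

Lp : ℕ → Poly → ℕ
Lp p h = sum (map (absRep p) h)

FarFromSquareFree : ℕ → Poly → Set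
FarFromSquareFree p f = ∀ g → SquareFree p g → 2 ≤ Lp p (f -ₚ g)

-- "N_p(d) ≥ n": there are at least n pairwise distinct polynomials in
-- F_p[x] of degree d that are far from all square-free polynomials
NAtLeast : ℕ → ℕ → ℕ → Set
NAtLeast p d n = ∃ λ (fs : List Poly) →
  n ≤ length fs
  × All (HasDegree p d) fs
  × All (FarFromSquareFree p) fs
  × AllPairs (λ f g → ¬ (f ≈[ p ] g)) fs

module Submission where

-- Let M be monic of degree m with M(0) ≢ 0, let deg r < m, and put
-- F(q) = x²·(r + M·q).  A polynomial h with L_p(h) ≤ 1 is 0 or ±xⁱ, so F(q) is
-- far from square-free as soon as F(q) and all F(q) ∓ xⁱ are divisible by the
-- square of a nonconstant polynomial.  For i ≥ 2 (and for F(q) itself) x²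
-- divides; for i = 0, 1 it suffices that x²r ∓ xⁱ and x²M share a square
-- factor H², since F(q) ∓ xⁱ = (x²r ∓ xⁱ) + x²M·q.  Moreover deg F(q) =
-- m + 2 + deg q and q ↦ F(q) is injective (M(0) is a unit), so letting q run
-- over the (p − 1)pⁿ polynomials of degree n gives N_p(m + 2 + n) ≥ (p − 1)pⁿ.
-- Explicit data (M, r, H) with m = 6 for p = 2, m = 12 for p = 3 and m = 8 for
-- p ≥ 5 (where r involves the inverse of 288 mod p) then give the theorem; the
-- polynomial identities in the data are checked by evaluation.

open import Defs
open import Data.Nat as ℕ using (ℕ; zero; suc; s≤s; z≤n; _≤_; _<_)
import Data.Nat.Properties as ℕP
open import Data.Nat.Divisibility using (∣⇒≤) renaming (_∣_ to _∣ℕ_)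
open import Data.Nat.Primality using (Prime; euclidsLemma; prime⇒irreducible)
open import Data.Nat.Coprimality using (Coprime; coprime-Bézout)
open import Data.Nat.GCD using (module Bézout)
import Data.Integer as ℤ
import Data.Integer.Properties as ℤP
import Data.Integer.Divisibility.Signed as S
open import Data.Integer.Divisibility using () renaming (_∣_ to _∣ℤ_)
open import Data.Integer.Tactic.RingSolver using (solve-∀)
open import Data.List using (List; []; _∷_; length; applyUpTo)
open import Data.List.Properties using (length-applyUpTo)
import Data.List.Relation.Unary.All.Properties as All
import Data.List.Relation.Unary.AllPairs.Properties as AllPairs
open import Data.Bool using (Bool; true; false; T; _∧_)
open import Data.Unit using (tt)
open import Data.Product using (Σ; _×_; _,_; proj₁; proj₂)
open import Data.Sum using (_⊎_; inj₁; inj₂)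
open import Data.Empty using (⊥-elim)
open import Relation.Nullary using (¬_; Dec; does; yes; no)
open import Relation.Nullary.Decidable using (from-yes; from-no)
open import Relation.Binary.Bundles using (Setoid)
open import Relation.Binary.PropositionalEquality
open import Function using (_∘_)

module IntegerPolynomials where

  open ℤ using (ℤ; +_; _+_; _*_; -_; _-_)

  infix 4 _≐_
  -- Equal coefficients in every degree (the lists may differ by trailing zeros).
  -- A record, so that the two polynomials can be inferred from a proof.
  record _≐_ (f g : Poly) : Set where
    constructor mk≐
    field coeff≡ : ∀ i → coeff f i ≡ coeff g i
  open _≐_ public

  ≐-setoid : Setoid _ _
  ≐-setoid = record
    { Carrier = Poly
    ; _≈_ = _≐_
    ; isEquivalence = record
      { refl = mk≐ λ _ → refl
      ; sym = λ e → mk≐ λ i → sym (coeff≡ e i)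
      ; trans = λ e e′ → mk≐ λ i → trans (coeff≡ e i) (coeff≡ e′ i)
      }
    }

  open Setoid ≐-setoid public using () renaming (refl to ≐-refl; sym to ≐-sym; trans to ≐-trans)

  cons-cong : ∀ {a f g} → f ≐ g → (a ∷ f) ≐ (a ∷ g)
  cons-cong e = mk≐ λ { zero → refl ; (suc i) → coeff≡ e i }

  monomial : ℕ → ℤ → Poly
  monomial zero    c = c ∷ []
  monomial (suc i) c = + 0 ∷ monomial i c

  PlusMinusOne : ℤ → Set
  PlusMinusOne c = c ≡ + 1 ⊎ c ≡ - + 1

  X : Poly
  X = + 0 ∷ + 1 ∷ []

  infixr 25 x²·_
  x²·_ : Poly → Poly
  x²· f = + 0 ∷ + 0 ∷ f

  coeff-beyond : ∀ f i → length f ≤ i → coeff f i ≡ + 0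
  coeff-beyond []      i       _         = refl
  coeff-beyond (a ∷ f) (suc i) (s≤s le) = coeff-beyond f i le

  coeff-+ : ∀ f g i → coeff (f +ₚ g) i ≡ coeff f i + coeff g i
  coeff-+ []      g       i       = sym (ℤP.+-identityˡ (coeff g i))
  coeff-+ (a ∷ f) []      i       = sym (ℤP.+-identityʳ (coeff (a ∷ f) i))
  coeff-+ (a ∷ f) (b ∷ g) zero    = refl
  coeff-+ (a ∷ f) (b ∷ g) (suc i) = coeff-+ f g i

  coeff-neg : ∀ f i → coeff (negₚ f) i ≡ - coeff f i
  coeff-neg []      i       = refl
  coeff-neg (a ∷ f) zero    = refl
  coeff-neg (a ∷ f) (suc i) = coeff-neg f i

  coeff-- : ∀ f g i → coeff (f -ₚ g) i ≡ coeff f i - coeff g i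
  coeff-- f g i = trans (coeff-+ f (negₚ g) i) (cong (λ z → coeff f i + z) (coeff-neg g i))

  coeff-scale : ∀ c f i → coeff (scale c f) i ≡ c * coeff f i
  coeff-scale c []      i       = sym (ℤP.*-zeroʳ c)
  coeff-scale c (a ∷ f) zero    = refl
  coeff-scale c (a ∷ f) (suc i) = coeff-scale c f i

  +-cong : ∀ {f f′ g g′} → f ≐ f′ → g ≐ g′ → (f +ₚ g) ≐ (f′ +ₚ g′)
  +-cong {f} {f′} {g} {g′} e e′ = mk≐ λ i → begin
    coeff (f +ₚ g) i         ≡⟨ coeff-+ f g i ⟩
    coeff f i + coeff g i     ≡⟨ cong₂ _+_ (coeff≡ e i) (coeff≡ e′ i) ⟩
    coeff f′ i + coeff g′ i   ≡⟨ coeff-+ f′ g′ i ⟨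
    coeff (f′ +ₚ g′) i       ∎
    where open ≡-Reasoning

  coeff-*-zero : ∀ a f g → coeff ((a ∷ f) *ₚ g) zero ≡ a * coeff g zero
  coeff-*-zero a f g = begin
    coeff ((a ∷ f) *ₚ g) zero   ≡⟨ coeff-+ (scale a g) (+ 0 ∷ (f *ₚ g)) zero ⟩
    coeff (scale a g) zero + + 0 ≡⟨ ℤP.+-identityʳ _ ⟩
    coeff (scale a g) zero      ≡⟨ coeff-scale a g zero ⟩
    a * coeff g zero            ∎
    where open ≡-Reasoning

  coeff-*-suc : ∀ a f g i →
    coeff ((a ∷ f) *ₚ g) (suc i) ≡ a * coeff g (suc i) + coeff (f *ₚ g) i
  coeff-*-suc a f g i = trans (coeff-+ (scale a g) (+ 0 ∷ (f *ₚ g)) (suc i))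
                              (cong (_+ coeff (f *ₚ g) i) (coeff-scale a g (suc i)))

  zero-* : ∀ f g → (∀ i → coeff f i ≡ + 0) → ∀ i → coeff (f *ₚ g) i ≡ + 0
  zero-* []      g z i       = refl
  zero-* (a ∷ f) g z zero    = begin
    coeff ((a ∷ f) *ₚ g) zero ≡⟨ coeff-*-zero a f g ⟩
    a * coeff g zero          ≡⟨ cong (_* coeff g zero) (z zero) ⟩
    + 0                       ∎
    where open ≡-Reasoning
  zero-* (a ∷ f) g z (suc i) = begin
    coeff ((a ∷ f) *ₚ g) (suc i)            ≡⟨ coeff-*-suc a f g i ⟩
    a * coeff g (suc i) + coeff (f *ₚ g) i  ≡⟨ cong₂ (λ u v → u * coeff g (suc i) + v)
                                                     (z zero) (zero-* f g (λ j → z (suc j)) i) ⟩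
    + 0 * coeff g (suc i) + + 0             ≡⟨ ℤP.+-identityʳ _ ⟩
    + 0                                     ∎
    where open ≡-Reasoning

  *-congˡ : ∀ {f f′} g → f ≐ f′ → (f *ₚ g) ≐ (f′ *ₚ g)
  *-congˡ {f} {f′} g e = mk≐ (go f f′ e)
    where
    open ≡-Reasoning
    go : ∀ f f′ → f ≐ f′ → ∀ i → coeff (f *ₚ g) i ≡ coeff (f′ *ₚ g) i
    go []      f′       e i       = sym (zero-* f′ g (λ j → sym (coeff≡ e j)) i)
    go (a ∷ f) []       e i       = zero-* (a ∷ f) g (coeff≡ e) i
    go (a ∷ f) (a′ ∷ f′) e zero    = begin
      coeff ((a ∷ f) *ₚ g) zero     ≡⟨ coeff-*-zero a f g ⟩
      a * coeff g zero              ≡⟨ cong (_* coeff g zero) (coeff≡ e zero) ⟩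
      a′ * coeff g zero             ≡⟨ coeff-*-zero a′ f′ g ⟨
      coeff ((a′ ∷ f′) *ₚ g) zero   ∎
    go (a ∷ f) (a′ ∷ f′) e (suc i) = begin
      coeff ((a ∷ f) *ₚ g) (suc i)             ≡⟨ coeff-*-suc a f g i ⟩
      a * coeff g (suc i) + coeff (f *ₚ g) i   ≡⟨ cong₂ (λ u v → u * coeff g (suc i) + v) (coeff≡ e zero)
                                                        (go f f′ (mk≐ λ j → coeff≡ e (suc j)) i) ⟩
      a′ * coeff g (suc i) + coeff (f′ *ₚ g) i ≡⟨ coeff-*-suc a′ f′ g i ⟨
      coeff ((a′ ∷ f′) *ₚ g) (suc i)           ∎

  *-congʳ : ∀ f {g g′} → g ≐ g′ → (f *ₚ g) ≐ (f *ₚ g′)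
  *-congʳ f {g} {g′} e = mk≐ (go f)
    where
    go : ∀ f i → coeff (f *ₚ g) i ≡ coeff (f *ₚ g′) i
    go []      i       = refl
    go (a ∷ f) zero    = trans (coeff-*-zero a f g)
      (trans (cong (a *_) (coeff≡ e zero)) (sym (coeff-*-zero a f g′)))
    go (a ∷ f) (suc i) = trans (coeff-*-suc a f g i)
      (trans (cong₂ (λ u v → a * u + v) (coeff≡ e (suc i)) (go f i)) (sym (coeff-*-suc a f g′ i)))

  scale-* : ∀ c f g → (scale c f *ₚ g) ≐ scale c (f *ₚ g)
  scale-* c f g = mk≐ λ i → trans (go f i) (sym (coeff-scale c (f *ₚ g) i))
    where
    open ≡-Reasoning
    go : ∀ f i → coeff (scale c f *ₚ g) i ≡ c * coeff (f *ₚ g) i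
    go []      i       = sym (ℤP.*-zeroʳ c)
    go (b ∷ f) zero    = begin
      coeff ((c * b ∷ scale c f) *ₚ g) zero ≡⟨ coeff-*-zero (c * b) (scale c f) g ⟩
      c * b * coeff g zero                 ≡⟨ ℤP.*-assoc c b _ ⟩
      c * (b * coeff g zero)               ≡⟨ cong (c *_) (coeff-*-zero b f g) ⟨
      c * coeff ((b ∷ f) *ₚ g) zero        ∎
    go (b ∷ f) (suc i) = begin
      coeff ((c * b ∷ scale c f) *ₚ g) (suc i)          ≡⟨ coeff-*-suc (c * b) (scale c f) g i ⟩
      c * b * coeff g (suc i) + coeff (scale c f *ₚ g) i ≡⟨ cong₂ _+_ (ℤP.*-assoc c b _) (go f i) ⟩
      c * (b * coeff g (suc i)) + c * coeff (f *ₚ g) i   ≡⟨ ℤP.*-distribˡ-+ c _ _ ⟨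
      c * (b * coeff g (suc i) + coeff (f *ₚ g) i)       ≡⟨ cong (c *_) (coeff-*-suc b f g i) ⟨
      c * coeff ((b ∷ f) *ₚ g) (suc i)                   ∎

  *-scale : ∀ c f g → (f *ₚ scale c g) ≐ scale c (f *ₚ g)
  *-scale c f g = mk≐ λ i → trans (go f i) (sym (coeff-scale c (f *ₚ g) i))
    where
    open ≡-Reasoning
    swap : ∀ b c x → b * (c * x) ≡ c * (b * x)
    swap = solve-∀
    go : ∀ f i → coeff (f *ₚ scale c g) i ≡ c * coeff (f *ₚ g) i
    go []      i       = sym (ℤP.*-zeroʳ c)
    go (b ∷ f) zero    = begin
      coeff ((b ∷ f) *ₚ scale c g) zero ≡⟨ coeff-*-zero b f (scale c g) ⟩
      b * coeff (scale c g) zero        ≡⟨ cong (b *_) (coeff-scale c g zero) ⟩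
      b * (c * coeff g zero)            ≡⟨ swap b c _ ⟩
      c * (b * coeff g zero)            ≡⟨ cong (c *_) (coeff-*-zero b f g) ⟨
      c * coeff ((b ∷ f) *ₚ g) zero     ∎
    go (b ∷ f) (suc i) = begin
      coeff ((b ∷ f) *ₚ scale c g) (suc i)                   ≡⟨ coeff-*-suc b f (scale c g) i ⟩
      b * coeff (scale c g) (suc i) + coeff (f *ₚ scale c g) i
        ≡⟨ cong₂ (λ u v → b * u + v) (coeff-scale c g (suc i)) (go f i) ⟩
      b * (c * coeff g (suc i)) + c * coeff (f *ₚ g) i        ≡⟨ cong (_+ c * coeff (f *ₚ g) i) (swap b c _) ⟩
      c * (b * coeff g (suc i)) + c * coeff (f *ₚ g) i        ≡⟨ ℤP.*-distribˡ-+ c _ _ ⟨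
      c * (b * coeff g (suc i) + coeff (f *ₚ g) i)            ≡⟨ cong (c *_) (coeff-*-suc b f g i) ⟨
      c * coeff ((b ∷ f) *ₚ g) (suc i)                        ∎

  shift-* : ∀ w q → ((+ 0 ∷ w) *ₚ q) ≐ (+ 0 ∷ (w *ₚ q))
  shift-* w q = mk≐ λ
    { zero    → coeff-*-zero (+ 0) w q
    ; (suc i) → trans (coeff-*-suc (+ 0) w q i) (ℤP.+-identityˡ (coeff (w *ₚ q) i)) }

  distribˡ : ∀ f g h → (f *ₚ (g +ₚ h)) ≐ ((f *ₚ g) +ₚ (f *ₚ h))
  distribˡ f g h = mk≐ λ i → trans (go f i) (sym (coeff-+ (f *ₚ g) (f *ₚ h) i))
    where
    open ≡-Reasoning
    rearrange : ∀ b x y u v → b * (x + y) + (u + v) ≡ (b * x + u) + (b * y + v)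
    rearrange = solve-∀
    go : ∀ f i → coeff (f *ₚ (g +ₚ h)) i ≡ coeff (f *ₚ g) i + coeff (f *ₚ h) i
    go []      i       = refl
    go (b ∷ f) zero    = begin
      coeff ((b ∷ f) *ₚ (g +ₚ h)) zero                   ≡⟨ coeff-*-zero b f (g +ₚ h) ⟩
      b * coeff (g +ₚ h) zero                            ≡⟨ cong (b *_) (coeff-+ g h zero) ⟩
      b * (coeff g zero + coeff h zero)                  ≡⟨ ℤP.*-distribˡ-+ b _ _ ⟩
      b * coeff g zero + b * coeff h zero                ≡⟨ cong₂ _+_ (coeff-*-zero b f g) (coeff-*-zero b f h) ⟨
      coeff ((b ∷ f) *ₚ g) zero + coeff ((b ∷ f) *ₚ h) zero ∎
    go (b ∷ f) (suc i) = begin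
      coeff ((b ∷ f) *ₚ (g +ₚ h)) (suc i)                   ≡⟨ coeff-*-suc b f (g +ₚ h) i ⟩
      b * coeff (g +ₚ h) (suc i) + coeff (f *ₚ (g +ₚ h)) i  ≡⟨ cong₂ (λ u v → b * u + v) (coeff-+ g h (suc i)) (go f i) ⟩
      b * (coeff g (suc i) + coeff h (suc i)) + (coeff (f *ₚ g) i + coeff (f *ₚ h) i)
                                                            ≡⟨ rearrange b _ _ _ _ ⟩
      (b * coeff g (suc i) + coeff (f *ₚ g) i) + (b * coeff h (suc i) + coeff (f *ₚ h) i)
                                                            ≡⟨ cong₂ _+_ (coeff-*-suc b f g i) (coeff-*-suc b f h i) ⟨
      coeff ((b ∷ f) *ₚ g) (suc i) + coeff ((b ∷ f) *ₚ h) (suc i) ∎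

  distribʳ : ∀ f g h → ((f +ₚ g) *ₚ h) ≐ ((f *ₚ h) +ₚ (g *ₚ h))
  distribʳ f g h = mk≐ λ i → trans (go f g i) (sym (coeff-+ (f *ₚ h) (g *ₚ h) i))
    where
    open ≡-Reasoning
    rearrange : ∀ a b x u v → (a + b) * x + (u + v) ≡ (a * x + u) + (b * x + v)
    rearrange = solve-∀
    go : ∀ f g i → coeff ((f +ₚ g) *ₚ h) i ≡ coeff (f *ₚ h) i + coeff (g *ₚ h) i
    go []      g       i       = sym (ℤP.+-identityˡ _)
    go (a ∷ f) []      i       = sym (ℤP.+-identityʳ _)
    go (a ∷ f) (b ∷ g) zero    = begin
      coeff ((a + b ∷ (f +ₚ g)) *ₚ h) zero ≡⟨ coeff-*-zero (a + b) (f +ₚ g) h ⟩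
      (a + b) * coeff h zero               ≡⟨ ℤP.*-distribʳ-+ _ a b ⟩
      a * coeff h zero + b * coeff h zero  ≡⟨ cong₂ _+_ (coeff-*-zero a f h) (coeff-*-zero b g h) ⟨
      coeff ((a ∷ f) *ₚ h) zero + coeff ((b ∷ g) *ₚ h) zero ∎
    go (a ∷ f) (b ∷ g) (suc i) = begin
      coeff ((a + b ∷ (f +ₚ g)) *ₚ h) (suc i)                ≡⟨ coeff-*-suc (a + b) (f +ₚ g) h i ⟩
      (a + b) * coeff h (suc i) + coeff ((f +ₚ g) *ₚ h) i     ≡⟨ cong (_+_ ((a + b) * coeff h (suc i))) (go f g i) ⟩
      (a + b) * coeff h (suc i) + (coeff (f *ₚ h) i + coeff (g *ₚ h) i) ≡⟨ rearrange a b _ _ _ ⟩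
      (a * coeff h (suc i) + coeff (f *ₚ h) i) + (b * coeff h (suc i) + coeff (g *ₚ h) i)
                                                             ≡⟨ cong₂ _+_ (coeff-*-suc a f h i) (coeff-*-suc b g h i) ⟨
      coeff ((a ∷ f) *ₚ h) (suc i) + coeff ((b ∷ g) *ₚ h) (suc i) ∎

  *-assoc : ∀ f g h → ((f *ₚ g) *ₚ h) ≐ (f *ₚ (g *ₚ h))
  *-assoc []      g h = ≐-refl
  *-assoc (a ∷ f) g h = begin
    (scale a g +ₚ (+ 0 ∷ (f *ₚ g))) *ₚ h           ≈⟨ distribʳ (scale a g) (+ 0 ∷ (f *ₚ g)) h ⟩
    (scale a g *ₚ h) +ₚ ((+ 0 ∷ (f *ₚ g)) *ₚ h)    ≈⟨ +-cong (scale-* a g h) (shift-* (f *ₚ g) h) ⟩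
    scale a (g *ₚ h) +ₚ (+ 0 ∷ ((f *ₚ g) *ₚ h))    ≈⟨ +-cong (≐-refl {scale a (g *ₚ h)}) (cons-cong (*-assoc f g h)) ⟩
    scale a (g *ₚ h) +ₚ (+ 0 ∷ (f *ₚ (g *ₚ h)))    ∎
    where open import Relation.Binary.Reasoning.Setoid ≐-setoid

  X-* : ∀ w → (X *ₚ w) ≐ (+ 0 ∷ w)
  X-* w = ≐-trans (shift-* (+ 1 ∷ []) w) (cons-cong (mk≐ one-*))
    where
    one-* : ∀ i → coeff ((+ 1 ∷ []) *ₚ w) i ≡ coeff w i
    one-* zero    = trans (coeff-*-zero (+ 1) [] w) (ℤP.*-identityˡ _)
    one-* (suc i) = trans (coeff-*-suc (+ 1) [] w i) (trans (ℤP.+-identityʳ _) (ℤP.*-identityˡ _))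

  X²-* : ∀ u → ((X *ₚ X) *ₚ u) ≐ (x²· u)
  X²-* u = ≐-trans (*-assoc X X u) (≐-trans (X-* (X *ₚ u)) (cons-cong (X-* u)))

  +-−-swap : ∀ A B δ → ((A +ₚ B) -ₚ δ) ≐ ((A -ₚ δ) +ₚ B)
  +-−-swap A B δ = mk≐ λ i → begin
    coeff ((A +ₚ B) -ₚ δ) i                ≡⟨ coeff-- (A +ₚ B) δ i ⟩
    coeff (A +ₚ B) i - coeff δ i           ≡⟨ cong (_- coeff δ i) (coeff-+ A B i) ⟩
    (coeff A i + coeff B i) - coeff δ i    ≡⟨ rearrange (coeff A i) (coeff B i) (coeff δ i) ⟩
    (coeff A i - coeff δ i) + coeff B i    ≡⟨ cong (_+ coeff B i) (coeff-- A δ i) ⟨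
    coeff (A -ₚ δ) i + coeff B i           ≡⟨ coeff-+ (A -ₚ δ) B i ⟨
    coeff ((A -ₚ δ) +ₚ B) i                ∎
    where
    open ≡-Reasoning
    rearrange : ∀ a b d → (a + b) - d ≡ (a - d) + b
    rearrange = solve-∀

  coeff-*-cons-zero : ∀ f b g → coeff (f *ₚ (b ∷ g)) zero ≡ coeff f zero * b
  coeff-*-cons-zero []      b g = refl
  coeff-*-cons-zero (a ∷ f) b g = coeff-*-zero a f (b ∷ g)

  coeff-*-cons-suc : ∀ f b g i →
    coeff (f *ₚ (b ∷ g)) (suc i) ≡ coeff f (suc i) * b + coeff (f *ₚ g) i
  coeff-*-cons-suc []      b g i = refl
  coeff-*-cons-suc (a ∷ f) b g zero = begin
    coeff ((a ∷ f) *ₚ (b ∷ g)) (suc zero)        ≡⟨ coeff-*-suc a f (b ∷ g) zero ⟩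
    a * coeff g zero + coeff (f *ₚ (b ∷ g)) zero ≡⟨ cong (_+_ (a * coeff g zero)) (coeff-*-cons-zero f b g) ⟩
    a * coeff g zero + coeff f zero * b          ≡⟨ ℤP.+-comm (a * coeff g zero) _ ⟩
    coeff f zero * b + a * coeff g zero          ≡⟨ cong (_+_ (coeff f zero * b)) (coeff-*-zero a f g) ⟨
    coeff f zero * b + coeff ((a ∷ f) *ₚ g) zero ∎
    where open ≡-Reasoning
  coeff-*-cons-suc (a ∷ f) b g (suc i) = begin
    coeff ((a ∷ f) *ₚ (b ∷ g)) (suc (suc i))
      ≡⟨ coeff-*-suc a f (b ∷ g) (suc i) ⟩
    a * coeff g (suc i) + coeff (f *ₚ (b ∷ g)) (suc i)
      ≡⟨ cong (_+_ (a * coeff g (suc i))) (coeff-*-cons-suc f b g i) ⟩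
    a * coeff g (suc i) + (coeff f (suc i) * b + coeff (f *ₚ g) i)
      ≡⟨ rearrange (a * coeff g (suc i)) (coeff f (suc i) * b) _ ⟩
    coeff f (suc i) * b + (a * coeff g (suc i) + coeff (f *ₚ g) i)
      ≡⟨ cong (_+_ (coeff f (suc i) * b)) (coeff-*-suc a f g i) ⟨
    coeff f (suc i) * b + coeff ((a ∷ f) *ₚ g) (suc i) ∎
    where
    open ≡-Reasoning
    rearrange : ∀ x y z → x + (y + z) ≡ y + (x + z)
    rearrange = solve-∀

  coeff-*-- : ∀ f g h i → coeff (f *ₚ (g -ₚ h)) i ≡ coeff (f *ₚ g) i - coeff (f *ₚ h) i
  coeff-*-- f g h i = begin
    coeff (f *ₚ (g +ₚ negₚ h)) i               ≡⟨ coeff≡ (distribˡ f g (negₚ h)) i ⟩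
    coeff ((f *ₚ g) +ₚ (f *ₚ negₚ h)) i        ≡⟨ coeff-+ (f *ₚ g) (f *ₚ negₚ h) i ⟩
    coeff (f *ₚ g) i + coeff (f *ₚ negₚ h) i   ≡⟨ cong (_+_ (coeff (f *ₚ g) i)) f·[−h] ⟩
    coeff (f *ₚ g) i - coeff (f *ₚ h) i        ∎
    where
    open ≡-Reasoning
    neg≐scale : negₚ h ≐ scale (- + 1) h
    neg≐scale = mk≐ λ j → trans (coeff-neg h j)
      (trans (sym (ℤP.-1*i≡-i (coeff h j))) (sym (coeff-scale (- + 1) h j)))
    f·[−h] : coeff (f *ₚ negₚ h) i ≡ - coeff (f *ₚ h) i
    f·[−h] = trans (coeff≡ (*-congʳ f neg≐scale) i)
      (trans (coeff≡ (*-scale (- + 1) f h) i)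
      (trans (coeff-scale (- + 1) (f *ₚ h) i) (ℤP.-1*i≡-i (coeff (f *ₚ h) i))))

  VanishesAbove : ℕ → Poly → Set
  VanishesAbove n f = ∀ i → n < i → coeff f i ≡ + 0

  *-top : ∀ f g a b → VanishesAbove a f → VanishesAbove b g →
    coeff (f *ₚ g) (a ℕ.+ b) ≡ coeff f a * coeff g b × VanishesAbove (a ℕ.+ b) (f *ₚ g)
  *-top []      g a       b _  _  = refl , λ _ _ → refl
  *-top (c ∷ f) g zero    b vf vg = top b , above
    where
    f≐0 : ∀ i → coeff f i ≡ + 0
    f≐0 i = vf (suc i) (s≤s z≤n)
    top : ∀ j → coeff ((c ∷ f) *ₚ g) j ≡ c * coeff g j
    top zero    = coeff-*-zero c f g
    top (suc j) = trans (coeff-*-suc c f g j)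
      (trans (cong (_+_ (c * coeff g (suc j))) (zero-* f g f≐0 j)) (ℤP.+-identityʳ _))
    above : VanishesAbove b ((c ∷ f) *ₚ g)
    above i b<i = trans (top i) (trans (cong (c *_) (vg i b<i)) (ℤP.*-zeroʳ c))
  *-top (c ∷ f) g (suc a) b vf vg = top , above
    where
    ih = *-top f g a b (λ i a<i → vf (suc i) (s≤s a<i)) vg
    top : coeff ((c ∷ f) *ₚ g) (suc (a ℕ.+ b)) ≡ coeff f a * coeff g b
    top = begin
      coeff ((c ∷ f) *ₚ g) (suc (a ℕ.+ b))         ≡⟨ coeff-*-suc c f g (a ℕ.+ b) ⟩
      c * coeff g (suc (a ℕ.+ b)) + coeff (f *ₚ g) (a ℕ.+ b)
        ≡⟨ cong₂ (λ u v → c * u + v) (vg _ (s≤s (ℕP.m≤n+m b a))) (proj₁ ih) ⟩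
      c * + 0 + coeff f a * coeff g b
        ≡⟨ trans (cong (_+ coeff f a * coeff g b) (ℤP.*-zeroʳ c)) (ℤP.+-identityˡ _) ⟩
      coeff f a * coeff g b                        ∎
      where open ≡-Reasoning
    above : VanishesAbove (suc (a ℕ.+ b)) ((c ∷ f) *ₚ g)
    above (suc i) (s≤s a+b<i) = begin
      coeff ((c ∷ f) *ₚ g) (suc i)            ≡⟨ coeff-*-suc c f g i ⟩
      c * coeff g (suc i) + coeff (f *ₚ g) i  ≡⟨ cong₂ (λ u v → c * u + v) (vg _ b<1+i) (proj₂ ih i a+b<i) ⟩
      c * + 0 + + 0                           ≡⟨ trans (ℤP.+-identityʳ _) (ℤP.*-zeroʳ c) ⟩
      + 0                                     ∎
      where
      open ≡-Reasoning
      b<1+i : b < suc i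
      b<1+i = s≤s (ℕP.≤-trans (ℕP.m≤n+m b a) (ℕP.<⇒≤ a+b<i))

open IntegerPolynomials

-- Congruence modulo p.  Divisibility is handled through the signed divisibility
-- relation of the library, a record (so the divided integer can be inferred);
-- it agrees with the relation used in the statement (S.∣⇒∣ᵤ, S.∣ᵤ⇒∣).
module Congruence (p : ℕ) where

  open ℤ using (ℤ; +_; _+_; _*_; -_; _-_)

  Dv : ℤ → Set
  Dv a = + p S.∣ a

  infix 4 _≈_
  record _≈_ (f g : Poly) : Set where
    constructor mk≈
    field coeff≈ : ∀ i → Dv (coeff f i - coeff g i)
  open _≈_ public

  private
    diff-trans : ∀ a b c → (a - b) + (b - c) ≡ a - c
    diff-trans = solve-∀
    diff-+ : ∀ a b c d → (a - c) + (b - d) ≡ (a + b) - (c + d)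
    diff-+ = solve-∀

  Dv-diff-sym : ∀ a b → Dv (a - b) → Dv (b - a)
  Dv-diff-sym a b = subst Dv (neg-diff a b) ∘ S.∣m⇒∣-m
    where
    neg-diff : ∀ a b → - (a - b) ≡ b - a
    neg-diff = solve-∀

  ≡⇒Dv-diff : ∀ {a b} → a ≡ b → Dv (a - b)
  ≡⇒Dv-diff {a} refl = S.divides (+ 0) (ℤP.+-inverseʳ a)

  ≈-setoid : Setoid _ _
  ≈-setoid = record
    { Carrier = Poly
    ; _≈_ = _≈_
    ; isEquivalence = record
      { refl  = λ {f} → mk≈ λ i → ≡⇒Dv-diff {coeff f i} refl
      ; sym   = λ {f} {g} e → mk≈ λ i → Dv-diff-sym (coeff f i) (coeff g i) (coeff≈ e i)
      ; trans = λ {f} {g} {h} e e′ → mk≈ λ i →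
          subst Dv (diff-trans (coeff f i) (coeff g i) (coeff h i))
                (S.∣m∣n⇒∣m+n (coeff≈ e i) (coeff≈ e′ i))
      }
    }

  open Setoid ≈-setoid public using () renaming (refl to ≈-refl; trans to ≈-trans)

  ≐⇒≈ : ∀ {f g} → f ≐ g → f ≈ g
  ≐⇒≈ e = mk≈ λ i → ≡⇒Dv-diff (coeff≡ e i)

  +-cong≈ : ∀ {f f′ g g′} → f ≈ f′ → g ≈ g′ → (f +ₚ g) ≈ (f′ +ₚ g′)
  +-cong≈ {f} {f′} {g} {g′} e e′ = mk≈ λ i →
    subst Dv (trans (diff-+ (coeff f i) (coeff g i) (coeff f′ i) (coeff g′ i))
                    (sym (cong₂ _-_ (coeff-+ f g i) (coeff-+ f′ g′ i))))
             (S.∣m∣n⇒∣m+n (coeff≈ e i) (coeff≈ e′ i))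

  ≈⇒≈[p] : ∀ {f g} → f ≈ g → f ≈[ p ] g
  ≈⇒≈[p] e i = S.∣⇒∣ᵤ (coeff≈ e i)

  ≈[p]⇒≈ : ∀ {f g} → f ≈[ p ] g → f ≈ g
  ≈[p]⇒≈ e = mk≈ λ i → S.∣ᵤ⇒∣ (e i)

  dv-euclid : Prime p → ∀ a b → Dv (a * b) → Dv a ⊎ Dv b
  dv-euclid pr a b d with euclidsLemma ℤ.∣ a ∣ ℤ.∣ b ∣ pr (subst (p ∣ℕ_) (ℤP.abs-* a b) (S.∣⇒∣ᵤ d))
  ... | inj₁ p∣a = inj₁ (S.∣ᵤ⇒∣ p∣a)
  ... | inj₂ p∣b = inj₂ (S.∣ᵤ⇒∣ p∣b)

  -- Over F_p a polynomial with nonzero constant term M(0) is not a zero divisor: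
  -- if M·h ≡ 0 then h ≡ 0, coefficient by coefficient from the bottom.
  unit-annihilates : Prime p → ∀ M → ¬ Dv (coeff M zero) →
    ∀ h → (∀ i → Dv (coeff (M *ₚ h) i)) → ∀ i → Dv (coeff h i)
  unit-annihilates pr M M₀ []      M·h≡0 i = S.divides (+ 0) refl
  unit-annihilates pr M M₀ (b ∷ h) M·h≡0 zero
    with dv-euclid pr (coeff M zero) b (subst Dv (coeff-*-cons-zero M b h) (M·h≡0 zero))
  ... | inj₁ p∣M₀ = ⊥-elim (M₀ p∣M₀)
  ... | inj₂ p∣b  = p∣b
  unit-annihilates pr M M₀ (b ∷ h) M·h≡0 (suc i) = unit-annihilates pr M M₀ h M·tail≡0 i
    where
    p∣b : Dv b
    p∣b = unit-annihilates pr M M₀ (b ∷ h) M·h≡0 zero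
    M·tail≡0 : ∀ j → Dv (coeff (M *ₚ h) j)
    M·tail≡0 j = S.∣m+n∣m⇒∣n (subst Dv (coeff-*-cons-suc M b h j) (M·h≡0 (suc j)))
                             (S.∣n⇒∣m*n (coeff M (suc j)) p∣b)

  *-cancelˡ : Prime p → ∀ M → ¬ Dv (coeff M zero) → ∀ q q′ → (M *ₚ q) ≈ (M *ₚ q′) → q ≈ q′
  *-cancelˡ pr M M₀ q q′ e = mk≈ λ i →
    subst Dv (coeff-- q q′ i) (unit-annihilates pr M M₀ (q -ₚ q′) M·[q−q′]≡0 i)
    where
    M·[q−q′]≡0 : ∀ j → Dv (coeff (M *ₚ (q -ₚ q′)) j)
    M·[q−q′]≡0 j = subst Dv (sym (coeff-*-- M q q′ j)) (coeff≈ e j)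

  private
    lift : ∀ a b c d → 1 ℕ.+ a ℕ.* b ≡ c ℕ.* d → + 1 + + a * + b ≡ + c * + d
    lift a b c d eq = begin
      + 1 + + a * + b        ≡⟨ cong (_+_ (+ 1)) (ℤP.pos-* a b) ⟨
      + 1 + + (a ℕ.* b)      ≡⟨ ℤP.pos-+ 1 (a ℕ.* b) ⟨
      + (1 ℕ.+ a ℕ.* b)      ≡⟨ cong +_ eq ⟩
      + (c ℕ.* d)            ≡⟨ ℤP.pos-* c d ⟩
      + c * + d              ∎
      where open ≡-Reasoning

  inverse : Prime p → ∀ n → ¬ p ∣ℕ n → Σ ℤ λ u → Dv (u * + n - + 1)
  inverse pr n p∤n with coprime-Bézout coprime
    where
    coprime : Coprime p n
    coprime (d∣p , d∣n) with prime⇒irreducible pr d∣p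
    ... | inj₁ d≡1    = d≡1
    ... | inj₂ refl   = ⊥-elim (p∤n d∣n)
  ... | Bézout.+- x y eq = - + y , S.divides (- + x) (begin
    - + y * + n - + 1       ≡⟨ rearrange (+ y) (+ n) ⟩
    - (+ 1 + + y * + n)     ≡⟨ cong -_ (lift y n x p eq) ⟩
    - (+ x * + p)           ≡⟨ ℤP.neg-distribˡ-* (+ x) (+ p) ⟩
    - + x * + p             ∎)
    where
    open ≡-Reasoning
    rearrange : ∀ y n → - y * n - + 1 ≡ - (+ 1 + y * n)
    rearrange = solve-∀
  ... | Bézout.-+ x y eq = + y , S.divides (+ x) (begin
    + y * + n - + 1         ≡⟨ cong (_- + 1) (sym (lift x p y n eq)) ⟩
    + 1 + + x * + p - + 1   ≡⟨ cancel (+ x * + p) ⟩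
    + x * + p               ∎)
    where
    open ≡-Reasoning
    cancel : ∀ z → + 1 + z - + 1 ≡ z
    cancel = solve-∀

  rescale : ∀ {u n} A δ B S → Dv (u * + n - + 1) →
    (A -ₚ scale (+ n) δ) ≐ (B *ₚ S) → (scale u A -ₚ δ) ≈ (B *ₚ scale u S)
  rescale {u} {n} A δ B S inv e = mk≈ λ i →
    subst Dv (sym (diff i)) (S.∣n⇒∣m*n (coeff δ i) inv)
    where
    open ≡-Reasoning
    rearrange : ∀ u a d n → (u * a - d) - u * (a - n * d) ≡ d * (u * n - + 1)
    rearrange = solve-∀
    diff : ∀ i → coeff (scale u A -ₚ δ) i - coeff (B *ₚ scale u S) i ≡ coeff δ i * (u * + n - + 1)
    diff i = begin
      coeff (scale u A -ₚ δ) i - coeff (B *ₚ scale u S) i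
        ≡⟨ cong₂ _-_ (trans (coeff-- (scale u A) δ i) (cong (_- coeff δ i) (coeff-scale u A i)))
                     (trans (coeff≡ (*-scale u B S) i) (coeff-scale u (B *ₚ S) i)) ⟩
      (u * coeff A i - coeff δ i) - u * coeff (B *ₚ S) i
        ≡⟨ cong (λ z → (u * coeff A i - coeff δ i) - u * z)
                (trans (sym (coeff≡ e i)) (trans (coeff-- A (scale (+ n) δ) i)
                                                 (cong (_-_ (coeff A i)) (coeff-scale (+ n) δ i)))) ⟩
      (u * coeff A i - coeff δ i) - u * (coeff A i - + n * coeff δ i)
        ≡⟨ rearrange u (coeff A i) (coeff δ i) (+ n) ⟩
      coeff δ i * (u * + n - + 1) ∎

module SquareFactors (p : ℕ) where

  open ℤ using (+_)
  open Congruence p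

  nonconstant : 2 ≤ p → ∀ H i → 1 ≤ i → coeff H i ≡ + 1 → DegreePos p H
  nonconstant (s≤s (s≤s _)) H i 1≤i Hᵢ≡1 = i , 1≤i , λ p∣Hᵢ →
    p≰1 (∣⇒≤ (subst (λ c → p ∣ℕ ℤ.∣ c ∣) Hᵢ≡1 p∣Hᵢ))
    where
    p≰1 : ¬ p ≤ 1
    p≰1 (s≤s ())

  nonconstant-x : 2 ≤ p → ∀ a rest → DegreePos p (a ∷ + 1 ∷ rest)
  nonconstant-x 2≤p a rest = nonconstant 2≤p (a ∷ + 1 ∷ rest) 1 (s≤s z≤n) refl

  HasSquareFactor : Poly → Set
  HasSquareFactor f = Σ Poly λ H → Σ Poly λ Q → DegreePos p H × f ≈ ((H *ₚ H) *ₚ Q)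

  squareFree⇒¬squareFactor : ∀ {g f} → SquareFree p g → g ≈ f → ¬ HasSquareFactor f
  squareFree⇒¬squareFactor sf g≈f (H , Q , H-nonconst , f≈H²Q) =
    sf H H-nonconst (Q , ≈⇒≈[p] (≈-trans g≈f f≈H²Q))

  CommonSquareFactor : Poly → Poly → Set
  CommonSquareFactor A B = Σ Poly λ H → Σ Poly λ S → Σ Poly λ T →
    DegreePos p H × A ≈ ((H *ₚ H) *ₚ S) × B ≐ ((H *ₚ H) *ₚ T)

  common⇒squareFactor : ∀ {A B} → CommonSquareFactor A B → ∀ q → HasSquareFactor (A +ₚ (B *ₚ q))
  common⇒squareFactor {A} {B} (H , S , T , H-nonconst , A≈ , B≐) q =
    H , (S +ₚ (T *ₚ q)) , H-nonconst , (begin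
      A +ₚ (B *ₚ q)                               ≈⟨ +-cong≈ A≈ (≐⇒≈ (*-congˡ q B≐)) ⟩
      ((H *ₚ H) *ₚ S) +ₚ (((H *ₚ H) *ₚ T) *ₚ q)   ≈⟨ ≐⇒≈ (+-cong (≐-refl {(H *ₚ H) *ₚ S}) (*-assoc (H *ₚ H) T q)) ⟩
      ((H *ₚ H) *ₚ S) +ₚ ((H *ₚ H) *ₚ (T *ₚ q))   ≈⟨ ≐⇒≈ (≐-sym (distribˡ (H *ₚ H) S (T *ₚ q))) ⟩
      (H *ₚ H) *ₚ (S +ₚ (T *ₚ q))                 ∎)
    where open import Relation.Binary.Reasoning.Setoid ≈-setoid

module ShortPolynomials (k : ℕ) where

  open ℤ using (ℤ; +_; _+_; _*_; -_; _-_; _%ℕ_; _/ℕ_)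
  open import Data.Integer.DivMod using (a≡a%ℕn+[a/ℕn]*n; n%ℕd<d)

  p : ℕ
  p = suc k

  open Congruence p
  open SquareFactors p

  absRep≡0 : ∀ c → absRep p c ≡ 0 → Dv c
  absRep≡0 c eq with (2 ℕ.* (c %ℕ p)) ℕ.≤ᵇ p
  ... | true  = S.divides (c /ℕ p) (begin
    c                               ≡⟨ a≡a%ℕn+[a/ℕn]*n c p ⟩
    + (c %ℕ p) + (c /ℕ p) * + p     ≡⟨ cong (λ r → + r + (c /ℕ p) * + p) eq ⟩
    + 0 + (c /ℕ p) * + p            ≡⟨ ℤP.+-identityˡ _ ⟩
    (c /ℕ p) * + p                  ∎)
    where open ≡-Reasoning
  ... | false = ⊥-elim (ℕP.<⇒≱ (n%ℕd<d c p) (ℕP.m∸n≡0⇒m≤n eq))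

  absRep≡1 : ∀ c → absRep p c ≡ 1 → Dv (c - + 1) ⊎ Dv (c - - + 1)
  absRep≡1 c eq with (2 ℕ.* (c %ℕ p)) ℕ.≤ᵇ p
  ... | true  = inj₁ (S.divides (c /ℕ p) (begin
    c - + 1                             ≡⟨ cong (_- + 1) (a≡a%ℕn+[a/ℕn]*n c p) ⟩
    + (c %ℕ p) + (c /ℕ p) * + p - + 1   ≡⟨ cong (λ r → + r + (c /ℕ p) * + p - + 1) eq ⟩
    + 1 + (c /ℕ p) * + p - + 1          ≡⟨ cancel ((c /ℕ p) * + p) ⟩
    (c /ℕ p) * + p                      ∎))
    where
    open ≡-Reasoning
    cancel : ∀ z → + 1 + z - + 1 ≡ z
    cancel = solve-∀
  ... | false = inj₂ (S.divides (c /ℕ p + + 1) (begin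
    c - - + 1                           ≡⟨ cong (_- - + 1) (a≡a%ℕn+[a/ℕn]*n c p) ⟩
    + r + (c /ℕ p) * + p - - + 1        ≡⟨ rearrange (+ r) (c /ℕ p) (+ p) ⟩
    (+ r + + 1) + (c /ℕ p) * + p        ≡⟨ cong (_+ (c /ℕ p) * + p) r+1≡p ⟩
    + p + (c /ℕ p) * + p                ≡⟨ collect (c /ℕ p) (+ p) ⟩
    (c /ℕ p + + 1) * + p                ∎))
    where
    open ≡-Reasoning
    r = c %ℕ p
    rearrange : ∀ r q P → r + q * P - - + 1 ≡ (r + + 1) + q * P
    rearrange = solve-∀
    collect : ∀ q P → P + q * P ≡ (q + + 1) * P
    collect = solve-∀
    -- here p − r = 1
    r+1≡p : + r + + 1 ≡ + p
    r+1≡p = begin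
      + r + + 1        ≡⟨ ℤP.pos-+ r 1 ⟨
      + (r ℕ.+ 1)      ≡⟨ cong +_ (ℕP.+-comm r 1) ⟩
      + (1 ℕ.+ r)      ≡⟨ cong (λ s → + (s ℕ.+ r)) eq ⟨
      + (p ℕ.∸ r ℕ.+ r) ≡⟨ cong +_ (ℕP.m∸n+n≡m (ℕP.<⇒≤ (n%ℕd<d c p))) ⟩
      + p              ∎

  Short : Poly → Set
  Short h = h ≈ [] ⊎ Σ ℕ λ i → Σ ℤ λ c → PlusMinusOne c × h ≈ monomial i c

  private
    cons≈ : ∀ {a b h g} → Dv (a - b) → h ≈ g → (a ∷ h) ≈ (b ∷ g)
    cons≈ d e = mk≈ λ { zero → d ; (suc i) → coeff≈ e i }

    zero-head : ∀ {a} → Dv a → Dv (a - + 0)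
    zero-head {a} = subst Dv (sym (ℤP.+-identityʳ a))

  Lp≤0⇒zero : ∀ h → Lp p h ≤ 0 → h ≈ []
  Lp≤0⇒zero []      _  = ≈-refl
  Lp≤0⇒zero (a ∷ h) le with absRep p a in eq
  ... | zero = mk≈ λ { zero → zero-head (absRep≡0 a eq) ; (suc i) → coeff≈ (Lp≤0⇒zero h le) i }

  Lp≤1⇒short : ∀ h → Lp p h ≤ 1 → Short h
  Lp≤1⇒short []      _  = inj₁ ≈-refl
  Lp≤1⇒short (a ∷ h) le with absRep p a in eq
  ... | zero with Lp≤1⇒short h le
  ...   | inj₁ h≈0 = inj₁ (mk≈ λ { zero → zero-head (absRep≡0 a eq) ; (suc i) → coeff≈ h≈0 i })
  ...   | inj₂ (i , c , ±1 , h≈cxⁱ) = inj₂ (suc i , c , ±1 , cons≈ (zero-head (absRep≡0 a eq)) h≈cxⁱ)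
  Lp≤1⇒short (a ∷ h) (s≤s le) | suc zero with absRep≡1 a eq
  ... | inj₁ a≡1  = inj₂ (0 , + 1 , inj₁ refl , cons≈ a≡1 (Lp≤0⇒zero h le))
  ... | inj₂ a≡-1 = inj₂ (0 , - + 1 , inj₂ refl , cons≈ a≡-1 (Lp≤0⇒zero h le))

  solve-for : ∀ {f g e} → (f -ₚ g) ≈ e → g ≈ (f -ₚ e)
  solve-for {f} {g} {e} d = mk≈ λ i →
    subst Dv (trans (rearrange (coeff f i) (coeff g i) (coeff e i))
                    (cong (_-_ (coeff g i)) (sym (coeff-- f e i))))
             (S.∣m⇒∣-m (subst Dv (cong (_- coeff e i) (coeff-- f g i)) (coeff≈ d i)))
    where
    rearrange : ∀ f g e → - ((f - g) - e) ≡ g - (f - e)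
    rearrange = solve-∀

  -- Criterion: if f and every f ∓ xⁱ have a square factor, then L_p(f − g) ≥ 2
  -- for every square-free g, since otherwise f − g would be 0 or ±xⁱ.
  far-from-squareFree : ∀ f → HasSquareFactor f →
    (∀ i c → PlusMinusOne c → HasSquareFactor (f -ₚ monomial i c)) → FarFromSquareFree p f
  far-from-squareFree f sq sq± g sf with Lp p (f -ₚ g) ℕ.≤? 1
  ... | no  L≰1 = ℕP.≰⇒> L≰1
  ... | yes L≤1 with Lp≤1⇒short (f -ₚ g) L≤1
  ...   | inj₁ f-g≈0 = ⊥-elim (squareFree⇒¬squareFactor {g} sf (≈-trans (solve-for {f} {g} f-g≈0) f-0≈f) sq)
    where
    f-0≈f : (f -ₚ []) ≈ f
    f-0≈f = ≐⇒≈ (mk≐ λ i → trans (coeff-- f [] i) (ℤP.+-identityʳ (coeff f i)))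
  ...   | inj₂ (i , c , ±1 , f-g≈cxⁱ) =
    ⊥-elim (squareFree⇒¬squareFactor {g} sf (solve-for {f} {g} f-g≈cxⁱ) (sq± i c ±1))

family-bound : ∀ p d N (G : ℕ → Poly) →
  (∀ {t} → t < N → HasDegree p d (G t)) →
  (∀ {t} → t < N → FarFromSquareFree p (G t)) →
  (∀ {s t} → s < N → t < N → G s ≈[ p ] G t → s ≡ t) →
  NAtLeast p d N
family-bound p d N G degree far injective =
  applyUpTo G N ,
  ℕP.≤-reflexive (sym (length-applyUpTo G N)) ,
  All.applyUpTo⁺₁ G N degree ,
  All.applyUpTo⁺₁ G N far ,
  AllPairs.applyUpTo⁺₁ G N (λ s<t t<N Gs≈Gt →
    ℕP.<⇒≢ s<t (injective (ℕP.<-trans s<t t<N) t<N Gs≈Gt))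

-- An enumeration of (p − 1)·pⁿ polynomials of degree n, pairwise incongruent
-- mod p: t is written in base p, and the last coefficient is 1 + (what remains).
module Enumeration (p : ℕ) .{{_ : ℕ.NonZero p}} where

  open ℤ using (+_; _-_)
  open import Data.Nat.DivMod using (_/_; _%_; m<n*o⇒m/o<n; m%n<n; m≡m%n+[m/n]*n)
  open Congruence p

  enum : ℕ → ℕ → Poly
  enum zero    t = + suc t ∷ []
  enum (suc n) t = + (t % p) ∷ enum n (t / p)

  leading : ℕ → ℕ → ℕ
  leading zero    t = t
  leading (suc n) t = leading n (t / p)

  enum-leading : ∀ n t → coeff (enum n t) n ≡ + suc (leading n t)
  enum-leading zero    t = refl
  enum-leading (suc n) t = enum-leading n (t / p)

  enum-top : ∀ n t → VanishesAbove n (enum n t)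
  enum-top zero    t (suc i) _         = refl
  enum-top (suc n) t (suc i) (s≤s n<i) = enum-top n (t / p) i n<i

  count : ℕ → ℕ
  count n = (p ℕ.∸ 1) ℕ.* p ℕ.^ n

  quotient-bound : ∀ n t → t < count (suc n) → t / p < count n
  quotient-bound n t t<count = m<n*o⇒m/o<n (subst (t <_) count-suc t<count)
    where
    count-suc : count (suc n) ≡ count n ℕ.* p
    count-suc = trans (cong ((p ℕ.∸ 1) ℕ.*_) (ℕP.*-comm p (p ℕ.^ n)))
                      (sym (ℕP.*-assoc (p ℕ.∸ 1) (p ℕ.^ n) p))

  leading-bound : ∀ n t → t < count n → suc (leading n t) < p
  leading-bound zero    t t<count = begin-strict
    suc t           ≤⟨ subst (t <_) (ℕP.*-identityʳ (p ℕ.∸ 1)) t<count ⟩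
    p ℕ.∸ 1         <⟨ ℕP.∸-monoʳ-< (s≤s z≤n) (ℕ.>-nonZero⁻¹ p) ⟩
    p               ∎
    where open ℕP.≤-Reasoning
  leading-bound (suc n) t t<count = leading-bound n (t / p) (quotient-bound n t t<count)

  small-multiple : ∀ {m} → m < p → p ∣ℕ m → m ≡ 0
  small-multiple {zero}  _   _   = refl
  small-multiple {suc m} m<p p∣m = ⊥-elim (ℕP.<⇒≱ m<p (∣⇒≤ p∣m))

  private
    ordered : ∀ {a b} → b ≤ a → a < p → Dv (+ a - + b) → a ≡ b
    ordered {a} {b} b≤a a<p p∣a-b = ℕP.≤-antisym (ℕP.m∸n≡0⇒m≤n a∸b≡0) b≤a
      where
      p∣a∸b : p ∣ℕ (a ℕ.∸ b)
      p∣a∸b = subst (λ z → p ∣ℕ ℤ.∣ z ∣) (trans (ℤP.m-n≡m⊖n a b) (ℤP.⊖-≥ b≤a)) (S.∣⇒∣ᵤ p∣a-b)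
      a∸b≡0 : a ℕ.∸ b ≡ 0
      a∸b≡0 = small-multiple (ℕP.≤-<-trans (ℕP.m∸n≤m a b) a<p) p∣a∸b

  residue-injective : ∀ {a b} → a < p → b < p → Dv (+ a - + b) → a ≡ b
  residue-injective {a} {b} a<p b<p p∣a-b with ℕP.≤-total b a
  ... | inj₁ b≤a = ordered b≤a a<p p∣a-b
  ... | inj₂ a≤b = sym (ordered a≤b b<p (Dv-diff-sym (+ a) (+ b) p∣a-b))

  -- Distinct indices give incongruent polynomials: compare digit by digit.
  enum-injective : ∀ n {s t} → s < count n → t < count n → enum n s ≈ enum n t → s ≡ t
  enum-injective zero    {s} {t} s<count t<count e = ℕP.suc-injective
    (residue-injective (leading-bound zero s s<count) (leading-bound zero t t<count) (coeff≈ e 0))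
  enum-injective (suc n) {s} {t} s<count t<count e = begin
    s                       ≡⟨ m≡m%n+[m/n]*n s p ⟩
    s % p ℕ.+ s / p ℕ.* p   ≡⟨ cong₂ (λ r q → r ℕ.+ q ℕ.* p) same-digit same-quotient ⟩
    t % p ℕ.+ t / p ℕ.* p   ≡⟨ m≡m%n+[m/n]*n t p ⟨
    t                       ∎
    where
    open ≡-Reasoning
    same-digit : s % p ≡ t % p
    same-digit = residue-injective (m%n<n s p) (m%n<n t p) (coeff≈ e 0)
    same-quotient : s / p ≡ t / p
    same-quotient = enum-injective n (quotient-bound n s s<count) (quotient-bound n t t<count)
                                     (mk≈ λ i → coeff≈ e (suc i))

module Construction
  (k : ℕ) (prime : Prime (suc (suc k)))
  (m : ℕ) (M r : Poly)
  (M-monic : coeff M m ≡ ℤ.+ 1)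
  (M-top : VanishesAbove m M)
  (M₀≢0 : ¬ Congruence.Dv (suc (suc k)) (coeff M 0))
  (r-top : ∀ i → m ≤ i → coeff r i ≡ ℤ.+ 0)
  (shared : ∀ j c → j < 2 → PlusMinusOne c →
     SquareFactors.CommonSquareFactor (suc (suc k))
       (x²· r -ₚ monomial j c) (x²· M))
  where

  open ℤ using (+_; _+_; _*_; _-_)

  p : ℕ
  p = suc (suc k)

  open Congruence p
  open SquareFactors p
  open ShortPolynomials (suc k) using (far-from-squareFree)
  open Enumeration p

  F : Poly → Poly
  F q = x²· (r +ₚ (M *ₚ q))

  X-nonconstant : DegreePos p X
  X-nonconstant = nonconstant (s≤s (s≤s z≤n)) X 1 (s≤s z≤n) refl

  x²-factor : ∀ u → HasSquareFactor (x²· u)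
  x²-factor u = X , u , X-nonconstant , ≐⇒≈ (≐-sym (X²-* u))

  low-square-factor : ∀ q j c → j < 2 → PlusMinusOne c → HasSquareFactor (F q -ₚ monomial j c)
  low-square-factor q j c j<2 ±1 with common⇒squareFactor (shared j c j<2 ±1) q
  ... | H , Q , H-nonconst , eq = H , Q , H-nonconst , ≈-trans (≐⇒≈ split) eq
    where
    x²M·q : (x²· M *ₚ q) ≐ x²· (M *ₚ q)
    x²M·q = ≐-trans (shift-* (+ 0 ∷ M) q) (cons-cong (shift-* M q))
    split : (F q -ₚ monomial j c) ≐ ((x²· r -ₚ monomial j c) +ₚ (x²· M *ₚ q))
    split = ≐-trans (+-−-swap (x²· r) (x²· (M *ₚ q)) (monomial j c))
                    (+-cong (≐-refl {x²· r -ₚ monomial j c}) (≐-sym x²M·q))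

  F-far : ∀ q → FarFromSquareFree p (F q)
  F-far q = far-from-squareFree (F q) (x²-factor _) square-factor
    where
    square-factor : ∀ i c → PlusMinusOne c → HasSquareFactor (F q -ₚ monomial i c)
    square-factor zero          c ±1 = low-square-factor q 0 c (s≤s z≤n) ±1
    square-factor (suc zero)    c ±1 = low-square-factor q 1 c (s≤s (s≤s z≤n)) ±1
    square-factor (suc (suc i)) c ±1 = x²-factor ((r +ₚ (M *ₚ q)) -ₚ monomial i c)

  coeff-F : ∀ q j → coeff (F q) (suc (suc j)) ≡ coeff r j + coeff (M *ₚ q) j
  coeff-F q = coeff-+ r (M *ₚ q)

  -- If q has degree n with leading coefficient 0 < a < p (as an integer), then
  -- F(q) has degree m + 2 + n: its top coefficient is that of M·q, namely a.
  F-degree : ∀ q n a → coeff q n ≡ + suc a → suc a < p → VanishesAbove n q →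
    HasDegree p (suc (suc (m ℕ.+ n))) (F q)
  F-degree q n a qₙ≡1+a 1+a<p q-top = top-not-divisible , above-divisible
    where
    product = *-top M q m n M-top q-top
    top : coeff (F q) (suc (suc (m ℕ.+ n))) ≡ + suc a
    top = begin
      coeff (F q) (suc (suc (m ℕ.+ n)))          ≡⟨ coeff-F q (m ℕ.+ n) ⟩
      coeff r (m ℕ.+ n) + coeff (M *ₚ q) (m ℕ.+ n)
        ≡⟨ cong₂ _+_ (r-top (m ℕ.+ n) (ℕP.m≤m+n m n)) (proj₁ product) ⟩
      + 0 + coeff M m * coeff q n                 ≡⟨ cong₂ (λ u v → + 0 + u * v) M-monic qₙ≡1+a ⟩
      + 1 * + suc a                               ≡⟨ ℤP.*-identityˡ _ ⟩
      + suc a                                     ∎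
      where open ≡-Reasoning
    top-not-divisible : ¬ (+ p ∣ℤ coeff (F q) (suc (suc (m ℕ.+ n))))
    top-not-divisible p∣top = ℕP.<⇒≱ 1+a<p (∣⇒≤ (subst (λ c → + p ∣ℤ c) top p∣top))
    above-divisible : ∀ i → suc (suc (m ℕ.+ n)) < i → + p ∣ℤ coeff (F q) i
    above-divisible (suc (suc j)) (s≤s (s≤s m+n<j)) =
      S.∣⇒∣ᵤ (subst Dv (sym vanishes) (S.divides (+ 0) refl))
      where
      vanishes : coeff (F q) (suc (suc j)) ≡ + 0
      vanishes = trans (coeff-F q j)
        (cong₂ _+_ (r-top j (ℕP.≤-trans (ℕP.m≤m+n m n) (ℕP.<⇒≤ m+n<j))) (proj₂ product j m+n<j))

  -- q ↦ F(q) is injective mod p, because M(0) is a unit.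
  F-injective : ∀ q q′ → F q ≈ F q′ → q ≈ q′
  F-injective q q′ e = *-cancelˡ prime M M₀≢0 q q′ (mk≈ λ j →
    subst Dv (trans (cong₂ _-_ (coeff-F q j) (coeff-F q′ j)) (cancel-r (coeff r j) _ _))
             (coeff≈ e (suc (suc j))))
    where
    cancel-r : ∀ a b c → (a + b) - (a + c) ≡ b - c
    cancel-r = solve-∀

  bound : ∀ n → NAtLeast p (suc (suc (m ℕ.+ n))) (count n)
  bound n = family-bound p _ (count n) (λ t → F (enum n t))
    (λ {t} t<count → F-degree (enum n t) n (leading n t) (enum-leading n t)
                              (leading-bound n t t<count) (enum-top n t))
    (λ {t} _ → F-far (enum n t))
    (λ s<count t<count e → enum-injective n s<count t<count
                             (F-injective (enum n _) (enum n _) (≈[p]⇒≈ e)))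

-- Coefficient identities between explicit polynomials, checked by evaluation:
-- a Boolean test of a decidable relation on corresponding coefficients.
module CoefficientCheck where

  open ℤ using (ℤ; +_; _-_)

  coeffwise : {P : ℤ → ℤ → Set} → (∀ a b → Dec (P a b)) → Poly → Poly → Bool
  coeffwise P? []      []      = true
  coeffwise P? []      (b ∷ g) = does (P? (+ 0) b) ∧ coeffwise P? [] g
  coeffwise P? (a ∷ f) []      = does (P? a (+ 0)) ∧ coeffwise P? f []
  coeffwise P? (a ∷ f) (b ∷ g) = does (P? a b) ∧ coeffwise P? f g

  coeffwise-sound : {P : ℤ → ℤ → Set} (P? : ∀ a b → Dec (P a b)) → P (+ 0) (+ 0) →
    ∀ f g → T (coeffwise P? f g) → ∀ i → P (coeff f i) (coeff g i)
  coeffwise-sound P? P00 []      []      _  i = P00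
  coeffwise-sound P? P00 []      (b ∷ g) ok i with P? (+ 0) b
  coeffwise-sound P? P00 []      (b ∷ g) ok zero    | yes P0b = P0b
  coeffwise-sound P? P00 []      (b ∷ g) ok (suc i) | yes _   = coeffwise-sound P? P00 [] g ok i
  coeffwise-sound P? P00 (a ∷ f) []      ok i with P? a (+ 0)
  coeffwise-sound P? P00 (a ∷ f) []      ok zero    | yes Pa0 = Pa0
  coeffwise-sound P? P00 (a ∷ f) []      ok (suc i) | yes _   = coeffwise-sound P? P00 f [] ok i
  coeffwise-sound P? P00 (a ∷ f) (b ∷ g) ok i with P? a b
  coeffwise-sound P? P00 (a ∷ f) (b ∷ g) ok zero    | yes Pab = Pab
  coeffwise-sound P? P00 (a ∷ f) (b ∷ g) ok (suc i) | yes _   = coeffwise-sound P? P00 f g ok i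

  check≐ : ∀ f g → T (coeffwise ℤ._≟_ f g) → f ≐ g
  check≐ f g ok = mk≐ (coeffwise-sound ℤ._≟_ refl f g ok)

  check≈ : ∀ p f g → T (coeffwise (λ a b → + p S.∣? (a - b)) f g) → Congruence._≈_ p f g
  check≈ p f g ok = Congruence.mk≈
    (coeffwise-sound (λ a b → + p S.∣? (a - b)) (S.divides (+ 0) refl) f g ok)

  checked : ∀ {p A B} H S K → DegreePos p H →
    T (coeffwise (λ a b → + p S.∣? (a - b)) A ((H *ₚ H) *ₚ S)) →
    T (coeffwise ℤ._≟_ B ((H *ₚ H) *ₚ K)) →
    SquareFactors.CommonSquareFactor p A B
  checked {p} H S K H-nonconst okS okK =
    H , S , K , H-nonconst , check≈ p _ _ okS , check≐ _ _ okK

open CoefficientCheck using (check≐; check≈; checked)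

-- p = 2, m = 6: M = ((1 + x)(1 + x + x²))², r = 1 + x + x² + x³ + x⁴.
-- Mod 2, x²r − xʲ is divisible by (1 + x)² for j = 0 and by (1 + x + x²)² for j = 1.
module CaseTwo where

  open ℤ using (+_)
  open import Data.Nat.Primality using (prime[2])
  open SquareFactors 2

  M r : Poly
  M = + 1 ∷ + 4 ∷ + 8 ∷ + 10 ∷ + 8 ∷ + 4 ∷ + 1 ∷ []
  r = + 1 ∷ + 1 ∷ + 1 ∷ + 1 ∷ + 1 ∷ []

  -- the same cofactors serve c = 1 and c = −1, which agree mod 2
  shared : ∀ j c → j < 2 → PlusMinusOne c → CommonSquareFactor (x²· r -ₚ monomial j c) (x²· M)
  shared zero c _ ±1 = both ±1
    where
    H S K : Poly
    H = + 1 ∷ + 1 ∷ []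
    S = + 1 ∷ + 0 ∷ + 0 ∷ + 1 ∷ + 1 ∷ []
    K = + 0 ∷ + 0 ∷ + 1 ∷ + 2 ∷ + 3 ∷ + 2 ∷ + 1 ∷ []
    both : ∀ {c} → PlusMinusOne c → CommonSquareFactor (x²· r -ₚ monomial 0 c) (x²· M)
    both (inj₁ refl) = checked H S K (nonconstant-x ℕP.≤-refl _ _) tt tt
    both (inj₂ refl) = checked H S K (nonconstant-x ℕP.≤-refl _ _) tt tt
  shared (suc zero) c _ ±1 = both ±1
    where
    H S K : Poly
    H = + 1 ∷ + 1 ∷ + 1 ∷ []
    S = + 0 ∷ + 1 ∷ + 1 ∷ []
    K = + 0 ∷ + 0 ∷ + 1 ∷ + 2 ∷ + 1 ∷ []
    both : ∀ {c} → PlusMinusOne c → CommonSquareFactor (x²· r -ₚ monomial 1 c) (x²· M)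
    both (inj₁ refl) = checked H S K (nonconstant-x ℕP.≤-refl _ _) tt tt
    both (inj₂ refl) = checked H S K (nonconstant-x ℕP.≤-refl _ _) tt tt
  shared (suc (suc j)) c (s≤s (s≤s ())) _

  M₀≢0 : ¬ Congruence.Dv 2 (+ 1)
  M₀≢0 = from-no (+ 2 S.∣? + 1)

  open Construction 0 prime[2] 6 M r refl (λ i → coeff-beyond M i) M₀≢0
                    (λ i 6≤i → coeff-beyond r i (ℕP.≤-trans (ℕP.n≤1+n 5) 6≤i)) shared
    public using (bound)

module CaseThree where

  open ℤ using (+_)
  open import Data.Nat.Primality using (prime?)
  open SquareFactors 3

  M r : Poly
  M = + 16 ∷ + 64 ∷ + 152 ∷ + 272 ∷ + 377 ∷ + 424 ∷ + 392 ∷ + 296 ∷ + 182 ∷ + 88 ∷ + 32 ∷ + 8 ∷ + 1 ∷ []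
  r = + 0 ∷ + 2 ∷ + 2 ∷ + 0 ∷ + 0 ∷ + 1 ∷ + 2 ∷ + 2 ∷ + 0 ∷ + 0 ∷ + 2 ∷ + 2 ∷ []

  2≤3 : 2 ≤ 3
  2≤3 = s≤s (s≤s z≤n)

  shared : ∀ j c → j < 2 → PlusMinusOne c → CommonSquareFactor (x²· r -ₚ monomial j c) (x²· M)
  shared zero c _ (inj₁ refl) = checked
    (+ 2 ∷ + 1 ∷ [])
    (+ 2 ∷ + 1 ∷ + 0 ∷ + 1 ∷ + 1 ∷ + 1 ∷ + 1 ∷ + 2 ∷ + 2 ∷ + 1 ∷ + 0 ∷ + 2 ∷ [])
    (+ 0 ∷ + 0 ∷ + 4 ∷ + 12 ∷ + 25 ∷ + 40 ∷ + 48 ∷ + 48 ∷ + 38 ∷ + 24 ∷ + 12 ∷ + 4 ∷ + 1 ∷ [])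
    (nonconstant-x 2≤3 _ _) tt tt
  shared zero c _ (inj₂ refl) = checked
    (+ 1 ∷ + 1 ∷ [])
    (+ 1 ∷ + 1 ∷ + 0 ∷ + 1 ∷ + 0 ∷ + 2 ∷ + 2 ∷ + 1 ∷ + 1 ∷ + 2 ∷ + 1 ∷ + 2 ∷ [])
    (+ 0 ∷ + 0 ∷ + 16 ∷ + 32 ∷ + 72 ∷ + 96 ∷ + 113 ∷ + 102 ∷ + 75 ∷ + 44 ∷ + 19 ∷ + 6 ∷ + 1 ∷ [])
    (nonconstant-x 2≤3 _ _) tt tt
  shared (suc zero) c _ (inj₁ refl) = checked
    (+ 1 ∷ + 0 ∷ + 1 ∷ [])
    (+ 0 ∷ + 2 ∷ + 0 ∷ + 1 ∷ + 2 ∷ + 2 ∷ + 2 ∷ + 2 ∷ + 2 ∷ + 2 ∷ [])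
    (+ 0 ∷ + 0 ∷ + 16 ∷ + 64 ∷ + 120 ∷ + 144 ∷ + 121 ∷ + 72 ∷ + 30 ∷ + 8 ∷ + 1 ∷ [])
    (nonconstant 2≤3 (+ 1 ∷ + 0 ∷ + 1 ∷ []) 2 (s≤s z≤n) refl) tt tt
  shared (suc zero) c _ (inj₂ refl) = checked
    (+ 2 ∷ + 1 ∷ + 1 ∷ [])
    (+ 0 ∷ + 1 ∷ + 2 ∷ + 1 ∷ + 1 ∷ + 1 ∷ + 2 ∷ + 0 ∷ + 1 ∷ + 2 ∷ [])
    (+ 0 ∷ + 0 ∷ + 4 ∷ + 12 ∷ + 21 ∷ + 30 ∷ + 31 ∷ + 24 ∷ + 15 ∷ + 6 ∷ + 1 ∷ [])
    (nonconstant-x 2≤3 _ _) tt tt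
  shared (suc (suc j)) c (s≤s (s≤s ())) _

  open Construction 1 (from-yes (prime? 3)) 12 M r refl (λ i → coeff-beyond M i)
                    (from-no (+ 3 S.∣? + 16)) (λ i → coeff-beyond r i) shared
    public using (bound)

-- p ≥ 5, m = 8.  Here the witnesses are integer identities
-- x²R − 288·c·xʲ = H²S₀, and r = u·R for an inverse u of 288 mod p; then
-- x²r − c·xʲ ≡ u·(x²R − 288·c·xʲ) ≡ H²·(u·S₀) mod p.
module CaseAtLeastFive (k : ℕ) (prime : Prime (suc (suc k))) (5≤p : 5 ≤ suc (suc k)) where

  open ℤ using (ℤ; +_; -_)
  open CoefficientCheck using (coeffwise)

  p : ℕ
  p = suc (suc k)

  open Congruence p
  open SquareFactors p

  ∤-small : ∀ n → suc n < 5 → ¬ p ∣ℕ suc n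
  ∤-small n 1+n<5 p∣1+n = ℕP.<⇒≱ (ℕP.<-≤-trans 1+n<5 5≤p) (∣⇒≤ p∣1+n)

  ∤-* : ∀ {a b} → ¬ p ∣ℕ a → ¬ p ∣ℕ b → ¬ p ∣ℕ a ℕ.* b
  ∤-* p∤a p∤b p∣ab with euclidsLemma _ _ prime p∣ab
  ... | inj₁ p∣a = p∤a p∣a
  ... | inj₂ p∣b = p∤b p∣b

  ∤-^ : ∀ {a} → ¬ p ∣ℕ a → ∀ e → ¬ p ∣ℕ a ℕ.^ e
  ∤-^ p∤a zero    = ∤-small 0 (s≤s (s≤s z≤n))
  ∤-^ p∤a (suc e) = ∤-* p∤a (∤-^ p∤a e)

  ∤2ᵃ3ᵇ : ∀ a b → ¬ p ∣ℕ 2 ℕ.^ a ℕ.* 3 ℕ.^ b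
  ∤2ᵃ3ᵇ a b = ∤-* (∤-^ (∤-small 1 (s≤s (s≤s (s≤s z≤n)))) a)
                  (∤-^ (∤-small 2 (s≤s (s≤s (s≤s (s≤s z≤n))))) b)

  -- u·288 ≡ 1 mod p, as 288 = 2⁵·3²
  u : ℤ
  u = proj₁ (inverse prime 288 (∤2ᵃ3ᵇ 5 2))

  u·288≡1 : Dv (u ℤ.* + 288 ℤ.- + 1)
  u·288≡1 = proj₂ (inverse prime 288 (∤2ᵃ3ᵇ 5 2))

  -- M(0) = 36 = 2²·3², and r = u·R has degree 7 < 8
  M R r : Poly
  M = + 36 ∷ + 60 ∷ - + 35 ∷ - + 110 ∷ - + 37 ∷ + 40 ∷ + 35 ∷ + 10 ∷ + 1 ∷ []
  R = + 960 ∷ - + 92 ∷ - + 1756 ∷ - + 809 ∷ + 632 ∷ + 598 ∷ + 164 ∷ + 15 ∷ []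
  r = scale u R

  M₀≢0 : ¬ Dv (+ 36)
  M₀≢0 p∣36 = ∤2ᵃ3ᵇ 2 2 (S.∣⇒∣ᵤ p∣36)

  r-top : ∀ i → 8 ≤ i → coeff r i ≡ + 0
  r-top i 8≤i = trans (coeff-scale u R i)
    (trans (cong (u ℤ.*_) (coeff-beyond R i 8≤i)) (ℤP.*-zeroʳ u))

  rescaled : ∀ {j c} H S₀ K → DegreePos p H →
    T (coeffwise ℤ._≟_ (x²· R -ₚ scale (+ 288) (monomial j c)) ((H *ₚ H) *ₚ S₀)) →
    T (coeffwise ℤ._≟_ (x²· M) ((H *ₚ H) *ₚ K)) →
    CommonSquareFactor (x²· r -ₚ monomial j c) (x²· M)
  rescaled {j} {c} H S₀ K H-nonconst ok₀ okK = H , scale u S₀ , K , H-nonconst , (begin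
    x²· r -ₚ monomial j c             ≈⟨ ≐⇒≈ (+-cong x²-scale (≐-refl {negₚ (monomial j c)})) ⟩
    scale u (x²· R) -ₚ monomial j c
      ≈⟨ rescale {u} {288} (x²· R) (monomial j c) (H *ₚ H) S₀ u·288≡1 (check≐ _ _ ok₀) ⟩
    (H *ₚ H) *ₚ scale u S₀            ∎) , check≐ _ _ okK
    where
    open import Relation.Binary.Reasoning.Setoid ≈-setoid
    x²-scale : x²· r ≐ scale u (x²· R)
    x²-scale = mk≐ λ
      { zero          → sym (ℤP.*-zeroʳ u)
      ; (suc zero)    → sym (ℤP.*-zeroʳ u)
      ; (suc (suc i)) → refl }

  2≤p : 2 ≤ p
  2≤p = s≤s (s≤s z≤n)

  shared : ∀ j c → j < 2 → PlusMinusOne c → CommonSquareFactor (x²· r -ₚ monomial j c) (x²· M)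
  shared zero c _ (inj₁ refl) = rescaled {0} {+ 1}
    (+ 1 ∷ + 1 ∷ [])
    (- + 288 ∷ + 576 ∷ + 96 ∷ - + 860 ∷ - + 132 ∷ + 315 ∷ + 134 ∷ + 15 ∷ [])
    (+ 0 ∷ + 0 ∷ + 36 ∷ - + 12 ∷ - + 47 ∷ - + 4 ∷ + 18 ∷ + 8 ∷ + 1 ∷ [])
    (nonconstant-x 2≤p _ _) tt tt
  shared zero c _ (inj₂ refl) = rescaled {0} { - + 1}
    (- + 1 ∷ + 1 ∷ [])
    (+ 288 ∷ + 576 ∷ + 1824 ∷ + 2980 ∷ + 2380 ∷ + 971 ∷ + 194 ∷ + 15 ∷ [])
    (+ 0 ∷ + 0 ∷ + 36 ∷ + 132 ∷ + 193 ∷ + 144 ∷ + 58 ∷ + 12 ∷ + 1 ∷ [])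
    (nonconstant-x 2≤p _ _) tt tt
  shared (suc zero) c _ (inj₁ refl) = rescaled {1} {+ 1}
    (+ 3 ∷ + 1 ∷ [])
    (+ 0 ∷ - + 32 ∷ + 128 ∷ - + 92 ∷ - + 148 ∷ + 19 ∷ + 74 ∷ + 15 ∷ [])
    (+ 0 ∷ + 0 ∷ + 4 ∷ + 4 ∷ - + 7 ∷ - + 8 ∷ + 2 ∷ + 4 ∷ + 1 ∷ [])
    (nonconstant-x 2≤p _ _) tt tt
  shared (suc zero) c _ (inj₂ refl) = rescaled {1} { - + 1}
    (+ 2 ∷ + 1 ∷ [])
    (+ 0 ∷ + 72 ∷ + 168 ∷ - + 209 ∷ - + 272 ∷ + 122 ∷ + 104 ∷ + 15 ∷ [])
    (+ 0 ∷ + 0 ∷ + 9 ∷ + 6 ∷ - + 17 ∷ - + 12 ∷ + 7 ∷ + 6 ∷ + 1 ∷ [])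
    (nonconstant-x 2≤p _ _) tt tt
  shared (suc (suc j)) c (s≤s (s≤s ())) _

  open Construction k prime 8 M r refl (λ i → coeff-beyond M i) M₀≢0 r-top shared
    public using (bound)

open import Data.Nat using (_*_; _∸_; _^_)

NAtLeast-mono : ∀ {p d m n} → m ≤ n → NAtLeast p d n → NAtLeast p d m
NAtLeast-mono m≤n (fs , n≤len , rest) = fs , ℕP.≤-trans m≤n n≤len , rest

theorem6p1 :
    (∀ d → 8 ≤ d → NAtLeast 2 d (2 ^ (d ∸ 8)))
    × (∀ d → 14 ≤ d → NAtLeast 3 d (2 * 3 ^ (d ∸ 14)))
    × (∀ p → Prime p → 5 ≤ p →
         NAtLeast p 15 ((p ∸ 2) * p ^ 5)
         × (∀ d → 16 ≤ d → NAtLeast p d ((p ∸ 1) * p ^ (d ∸ 10))))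
theorem6p1 = p≡2 , p≡3 , p≥5
  where
  -- the construction gives N_p(m + 2 + n) ≥ (p − 1)pⁿ, with m + 2 = 8, 14, 10
  p≡2 : ∀ d → 8 ≤ d → NAtLeast 2 d (2 ^ (d ∸ 8))
  p≡2 d 8≤d = subst₂ (NAtLeast 2) (ℕP.m+[n∸m]≡n 8≤d) (ℕP.*-identityˡ _) (CaseTwo.bound (d ∸ 8))

  p≡3 : ∀ d → 14 ≤ d → NAtLeast 3 d (2 * 3 ^ (d ∸ 14))
  p≡3 d 14≤d = subst (λ e → NAtLeast 3 e (2 * 3 ^ (d ∸ 14)))
    (ℕP.m+[n∸m]≡n 14≤d) (CaseThree.bound (d ∸ 14))

  p≥5 : ∀ p → Prime p → 5 ≤ p →
    NAtLeast p 15 ((p ∸ 2) * p ^ 5) × (∀ d → 16 ≤ d → NAtLeast p d ((p ∸ 1) * p ^ (d ∸ 10)))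
  p≥5 p@(suc (suc k)) p-prime 5≤p = degree-15 , degree-≥16
    where
    open CaseAtLeastFive k p-prime 5≤p using (bound)
    -- degree 15 = 10 + 5, and (p − 2)p⁵ ≤ (p − 1)p⁵
    degree-15 : NAtLeast p 15 ((p ∸ 2) * p ^ 5)
    degree-15 = NAtLeast-mono (ℕP.*-monoˡ-≤ (p ^ 5) (ℕP.∸-monoʳ-≤ {1} {2} p (s≤s z≤n))) (bound 5)
    degree-≥16 : ∀ d → 16 ≤ d → NAtLeast p d ((p ∸ 1) * p ^ (d ∸ 10))
    degree-≥16 d 16≤d = subst (λ e → NAtLeast p e ((p ∸ 1) * p ^ (d ∸ 10)))
      (ℕP.m+[n∸m]≡n (ℕP.≤-trans (ℕP.m≤n+m 10 6) 16≤d)) (bound (d ∸ 10))
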